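{- Let $d>1$ be an integer, $q$ a prime power with $q\equiv 1\pmod d$, and $\omega\in\mathbb{F}_q$ a primitive $d$-th root of unity. For $0\le i\le d-1$ let $$A_i(x)=x^{q^{d-1}}+\omega^i x^{q^{d-2}}+\cdots+\omega^{i(d-1)}x.$$ For any $u_0,\dots,u_{d-1}\in\mathbb{F}_q^\ast$ with $u_i\omega^i=u_j\omega^j$ for all $0\le i,j\le d-1$, the polynomial $$f(x)=\sum_{i=0}^{d-1}u_iA_i(x)^{q^d-2}$$ is an involution of $\mathbb{F}_{q^d}$, i.e. $f(f(a))=a$ for all $a\in\mathbb{F}_{q^d}$. -}

module Defs where

open import Level using (Level; _⊔_)
open import Data.Nat using (ℕ; zero; suc; _^_; _≤_; _<_; _∸_) renaming (_*_ to _*ℕ_)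
open import Data.Nat.Primality using (Prime)
open import Data.Fin using (Fin)
open import Data.Product using (Σ; ∃; _×_)
open import Relation.Nullary using (¬_)
open import Relation.Binary.PropositionalEquality using (_≡_) renaming (setoid to ≡-setoid)
open import Algebra.Bundles using (CommutativeRing; Semiring)
open import Function.Bundles using (Inverse)
import Algebra.Definitions.RawSemiring as RS

IsPrimePower : ℕ → Set
IsPrimePower q = Σ ℕ λ p → Σ ℕ λ k → Prime p × (1 ≤ k) × (q ≡ p ^ k)

module _ {c ℓ : Level} (R : CommutativeRing c ℓ) where
  open CommutativeRing R

  IsField : Set (c ⊔ ℓ)
  IsField = (¬ (1# ≈ 0#)) × (∀ x → ¬ (x ≈ 0#) → ∃ λ y → x * y ≈ 1#)

  HasCardinality : ℕ → Set (c ⊔ ℓ)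
  HasCardinality n = Inverse setoid (≡-setoid (Fin n))

  infixr 8 _^ᴿ_
  _^ᴿ_ : Carrier → ℕ → Carrier
  _^ᴿ_ = RS._^_ (Semiring.rawSemiring semiring)

  sumTo : ℕ → (ℕ → Carrier) → Carrier
  sumTo zero    g = 0#
  sumTo (suc n) g = sumTo n g + g n

  InSubfield : ℕ → Carrier → Set ℓ
  InSubfield q x = x ^ᴿ q ≈ x

  PrimitiveRoot : ℕ → Carrier → Set ℓ
  PrimitiveRoot d ω = (ω ^ᴿ d ≈ 1#) × (∀ k → 1 ≤ k → k < d → ¬ (ω ^ᴿ k ≈ 1#))

  Apoly : ℕ → ℕ → Carrier → ℕ → Carrier → Carrier
  Apoly q d ω i x = sumTo d (λ k → (ω ^ᴿ (i *ℕ k)) * (x ^ᴿ (q ^ (d ∸ 1 ∸ k))))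

  fpoly : ℕ → ℕ → Carrier → (ℕ → Carrier) → Carrier → Carrier
  fpoly q d ω u x = sumTo d (λ i → u i * (Apoly q d ω i x ^ᴿ (q ^ d ∸ 2)))

{-# OPTIONS --safe #-}
module Submission where

-- The Aᵢ are eigenvectors of the Frobenius x ↦ x^q with eigenvalue ωⁱ, so yᵢ = Aᵢ(x)^(q^d−2),
-- which is Aᵢ(x)⁻¹ (or 0), has eigenvalue ω⁻ⁱ. Hence the conjugates f(x)^(q^s) = ∑ᵢ uᵢ ω^(−is) yᵢ
-- form a discrete Fourier transform of (yᵢ), and orthogonality of the d-th roots of unity gives
-- A_k(f(x)) = u₀ d · y₋ₖ, i.e. A_k(f(x))^(q^d−2) = (u₀ d)⁻¹ A₋ₖ(x). As uₖ = u₀ ω⁻ᵏ, a second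
-- orthogonality sum gives ∑ₖ uₖ A₋ₖ(x) = u₀ d · x, whence f(f(x)) = x. Additivity of x ↦ x^q
-- comes from the binomial theorem in characteristic p; x^(q^d) = x and char K = p come from
-- comparing the sums and products over all of K before and after a translation or a scaling.

open import Level using (Level; _⊔_)
open import Function using (_∘_)
open import Data.Empty using (⊥-elim)
open import Data.Product using (_,_; proj₁; proj₂)
open import Data.Sum using (inj₁; inj₂)
open import Relation.Nullary using (¬_; yes; no; contradiction)
open import Relation.Binary.Definitions using (Decidable; tri<; tri≈; tri>)
open import Relation.Binary.PropositionalEquality as ≡ using (_≡_; _≢_)
open import Data.Nat as ℕ
  using (ℕ; zero; suc; z≤n; s≤s; _<_; _≤_; _∸_; _!)
  renaming (_+_ to _+ℕ_; _*_ to _*ℕ_; _^_ to _^ℕ_)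
import Data.Nat.Properties as ℕ
open import Data.Nat.Divisibility using (_∣_; _∤_; divides; ∣1⇒≡1; ∣⇒≤; m∣m*n)
open import Data.Nat.DivMod using (m*[n/m]≡n)
open import Data.Nat.Combinatorics using (_C_; nCk≡n!/k![n-k]!; k![n∸k]!∣n!; nCn≡1; nCk≡nC[n∸k])
open import Data.Nat.Primality using (Prime; euclidsLemma; prime⇒nonTrivial)
open import Data.Fin as Fin using (Fin)
import Data.Fin.Properties as Fin
open import Function.Bundles using (Inverse)
import Function.Construct.Composition as Compose
import Function.Construct.Symmetry as Symmetry
open import Algebra.Bundles using (CommutativeRing; CommutativeMonoid)
open import Defs
  using (IsPrimePower; IsField; HasCardinality; InSubfield; PrimitiveRoot; _^ᴿ_; sumTo; Apoly; fpoly)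

prime>1 : ∀ {p} → Prime p → 1 < p
prime>1 {p} p-prime = ℕ.nonTrivial⇒n>1 p {{prime⇒nonTrivial p-prime}}

prime∤m! : ∀ {p} → Prime p → ∀ m → m < p → p ∤ m !
prime∤m! p-prime zero    m<p p∣1 = ℕ.<-irrefl (≡.sym (∣1⇒≡1 p∣1)) (prime>1 p-prime)
prime∤m! p-prime (suc m) m<p p∣m! with euclidsLemma (suc m) (m !) p-prime p∣m!
... | inj₁ p∣1+m = ℕ.<⇒≱ m<p (∣⇒≤ p∣1+m)
... | inj₂ p∣m!  = prime∤m! p-prime m (ℕ.<-trans (ℕ.n<1+n m) m<p) p∣m!

-- p divides p! = k! (p − k)! · C(p, k) but neither k! nor (p − k)!.
prime∣C : ∀ {p k} → Prime p → 0 < k → k < p → p ∣ p C k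
prime∣C {p@(suc p′)} {k} p-prime 0<k k<p with euclidsLemma _ (p C k) p-prime p∣k![p∸k]!*pCk
  where
  instance _ = k ℕ.!* (p ∸ k) !≢0
  k≤p = ℕ.<⇒≤ k<p
  p∣k![p∸k]!*pCk : p ∣ (k ! *ℕ (p ∸ k) !) *ℕ (p C k)
  p∣k![p∸k]!*pCk = ≡.subst (p ∣_) (≡.sym (≡.trans
    (≡.cong ((k ! *ℕ (p ∸ k) !) *ℕ_) (nCk≡n!/k![n-k]! k≤p)) (m*[n/m]≡n (k![n∸k]!∣n! k≤p)))) (m∣m*n (p′ !))
... | inj₂ p∣pCk = p∣pCk
... | inj₁ p∣k![p∸k]! with euclidsLemma _ _ p-prime p∣k![p∸k]!
...   | inj₁ p∣k!     = ⊥-elim (prime∤m! p-prime k k<p p∣k!)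
...   | inj₂ p∣[p∸k]! = ⊥-elim (prime∤m! p-prime (p ∸ k) (ℕ.∸-monoʳ-< 0<k (ℕ.<⇒≤ k<p)) p∣[p∸k]!)

suc[n∸1∸j]≡n∸j : ∀ {n j} → j < n → suc (n ∸ 1 ∸ j) ≡ n ∸ j
suc[n∸1∸j]≡n∸j {n} {j} j<n = ≡.trans (≡.cong suc (ℕ.∸-+-assoc n 1 j)) (≡.sym (ℕ.+-∸-assoc 1 j<n))

module Sums {c ℓ} (K : CommutativeRing c ℓ) where
  open CommutativeRing K
  open import Relation.Binary.Reasoning.Setoid setoid
  open import Algebra.Solver.Ring.NaturalCoefficients.Default commutativeSemiring
  open import Algebra.Properties.Semiring.Mult semiring using (_×_)

  ∑ : ℕ → (ℕ → Carrier) → Carrier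
  ∑ = sumTo K

  ∑-cong : ∀ n {g h : ℕ → Carrier} → (∀ i → i < n → g i ≈ h i) → ∑ n g ≈ ∑ n h
  ∑-cong zero    g≈h = refl
  ∑-cong (suc n) g≈h = +-cong (∑-cong n λ i i<n → g≈h i (ℕ.m<n⇒m<1+n i<n)) (g≈h n ℕ.≤-refl)

  ∑-zero : ∀ n {g : ℕ → Carrier} → (∀ i → i < n → g i ≈ 0#) → ∑ n g ≈ 0#
  ∑-zero zero    g≈0 = refl
  ∑-zero (suc n) g≈0 = begin
    ∑ n _ + _ ≈⟨ +-cong (∑-zero n λ i i<n → g≈0 i (ℕ.m<n⇒m<1+n i<n)) (g≈0 n ℕ.≤-refl) ⟩
    0# + 0#   ≈⟨ +-identityˡ 0# ⟩
    0#        ∎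

  ∑-distrib-+ : ∀ n (g h : ℕ → Carrier) → ∑ n (λ i → g i + h i) ≈ ∑ n g + ∑ n h
  ∑-distrib-+ zero    g h = sym (+-identityˡ 0#)
  ∑-distrib-+ (suc n) g h = begin
    ∑ n (λ i → g i + h i) + (g n + h n)  ≈⟨ +-congʳ (∑-distrib-+ n g h) ⟩
    (∑ n g + ∑ n h) + (g n + h n)        ≈⟨ interchange (∑ n g) (∑ n h) (g n) (h n) ⟩
    (∑ n g + g n) + (∑ n h + h n)        ∎
    where
    interchange : ∀ a b c d → (a + b) + (c + d) ≈ (a + c) + (b + d)
    interchange = solve 4 (λ a b c d → (a :+ b) :+ (c :+ d) := (a :+ c) :+ (b :+ d)) refl

  *-distribˡ-∑ : ∀ n a (g : ℕ → Carrier) → a * ∑ n g ≈ ∑ n (λ i → a * g i)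
  *-distribˡ-∑ zero    a g = zeroʳ a
  *-distribˡ-∑ (suc n) a g = trans (distribˡ a _ _) (+-congʳ (*-distribˡ-∑ n a g))

  ∑-comm : ∀ m n (f : ℕ → ℕ → Carrier) → ∑ m (λ i → ∑ n (f i)) ≈ ∑ n (λ j → ∑ m (λ i → f i j))
  ∑-comm zero    n f = sym (∑-zero n λ _ _ → refl)
  ∑-comm (suc m) n f = trans (+-congʳ (∑-comm m n f)) (sym (∑-distrib-+ n _ (f m)))

  ∑-select : ∀ n (g : ℕ → Carrier) {i₀} → i₀ < n →
             (∀ i → i < n → i ≢ i₀ → g i ≈ 0#) → ∑ n g ≈ g i₀
  ∑-select (suc n) g {i₀} i₀<1+n g≈0 with i₀ ℕ.≟ n
  ... | yes ≡.refl = begin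
    ∑ n g + g i₀ ≈⟨ +-congʳ (∑-zero n λ i i<n → g≈0 i (ℕ.m<n⇒m<1+n i<n) (ℕ.<⇒≢ i<n)) ⟩
    0# + g i₀    ≈⟨ +-identityˡ (g i₀) ⟩
    g i₀         ∎
  ... | no i₀≢n = begin
    ∑ n g + g n ≈⟨ +-cong (∑-select n g i₀<n λ i i<n → g≈0 i (ℕ.m<n⇒m<1+n i<n))
                          (g≈0 n ℕ.≤-refl (i₀≢n ∘ ≡.sym)) ⟩
    g i₀ + 0#   ≈⟨ +-identityʳ (g i₀) ⟩
    g i₀        ∎
    where
    i₀<n = ℕ.≤∧≢⇒< (ℕ.≤-pred i₀<1+n) i₀≢n

  ∑-rotate : ∀ n (g : ℕ → Carrier) → ∑ n (g ∘ suc) + g 0 ≈ ∑ n g + g n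
  ∑-rotate zero    g = refl
  ∑-rotate (suc n) g = begin
    (∑ n (g ∘ suc) + g (suc n)) + g 0 ≈⟨ swap (∑ n (g ∘ suc)) (g (suc n)) (g 0) ⟩
    (∑ n (g ∘ suc) + g 0) + g (suc n) ≈⟨ +-congʳ (∑-rotate n g) ⟩
    (∑ n g + g n) + g (suc n)         ∎
    where
    swap : ∀ a b c → (a + b) + c ≈ (a + c) + b
    swap = solve 3 (λ a b c → (a :+ b) :+ c := (a :+ c) :+ b) refl

  ∑-const : ∀ n x → ∑ n (λ _ → x) ≈ n × x
  ∑-const zero    x = refl
  ∑-const (suc n) x = trans (+-congʳ (∑-const n x)) (+-comm (n × x) x)

  ∑-homo : (φ : Carrier → Carrier) → φ 0# ≈ 0# → (∀ x y → φ (x + y) ≈ φ x + φ y) →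
           ∀ n g → φ (∑ n g) ≈ ∑ n (φ ∘ g)
  ∑-homo φ φ-0 φ-+ zero    g = φ-0
  ∑-homo φ φ-0 φ-+ (suc n) g = trans (φ-+ _ _) (+-congʳ (∑-homo φ φ-0 φ-+ n g))

module Field {c ℓ} (K : CommutativeRing c ℓ) (isField : IsField K) where
  open CommutativeRing K
  open import Relation.Binary.Reasoning.Setoid setoid
  open import Algebra.Properties.CommutativeSemiring.Exp commutativeSemiring using (_^_; ^-congˡ; ^-homo-*; ^-distrib-*)
  open import Algebra.Solver.Ring.NaturalCoefficients.Default commutativeSemiring
  open import Algebra.Properties.Semiring.Mult semiring using (_×_; ×1-homo-*)
  open import Algebra.Properties.Ring ring using ([y-z]x≈yx-zx)
  open import Algebra.Properties.Group +-group using (x∙y⁻¹≈ε⇒x≈y) renaming (∙-cancelʳ to +-cancelʳ)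
  open Sums K

  1≉0 : 1# ≉ 0#
  1≉0 = proj₁ isField

  x≉0∧x*y≈0⇒y≈0 : ∀ {x y} → x ≉ 0# → x * y ≈ 0# → y ≈ 0#
  x≉0∧x*y≈0⇒y≈0 {x} {y} x≉0 xy≈0 with proj₂ isField x x≉0
  ... | x⁻¹ , xx⁻¹≈1 = begin
    y                ≈⟨ *-identityˡ y ⟨
    1# * y           ≈⟨ *-congʳ (trans (*-comm x⁻¹ x) xx⁻¹≈1) ⟨
    (x⁻¹ * x) * y    ≈⟨ *-assoc x⁻¹ x y ⟩
    x⁻¹ * (x * y)    ≈⟨ *-congˡ xy≈0 ⟩
    x⁻¹ * 0#         ≈⟨ zeroʳ x⁻¹ ⟩
    0#               ∎

  x≉0∧y≉0⇒x*y≉0 : ∀ {x y} → x ≉ 0# → y ≉ 0# → x * y ≉ 0#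
  x≉0∧y≉0⇒x*y≉0 x≉0 y≉0 xy≈0 = y≉0 (x≉0∧x*y≈0⇒y≈0 x≉0 xy≈0)

  1^n≈1 : ∀ n → 1# ^ n ≈ 1#
  1^n≈1 zero    = refl
  1^n≈1 (suc n) = trans (*-identityˡ (1# ^ n)) (1^n≈1 n)

  0^n≈0 : ∀ {n} → 0 < n → 0# ^ n ≈ 0#
  0^n≈0 {suc n} _ = zeroˡ (0# ^ n)

  x≉0⇒x^n≉0 : ∀ {x} n → x ≉ 0# → x ^ n ≉ 0#
  x≉0⇒x^n≉0 zero    x≉0 = 1≉0
  x≉0⇒x^n≉0 (suc n) x≉0 = x≉0∧y≉0⇒x*y≉0 x≉0 (x≉0⇒x^n≉0 n x≉0)

  *-cancelʳ : ∀ {x y z} → z ≉ 0# → x * z ≈ y * z → x ≈ y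
  *-cancelʳ {x} {y} {z} z≉0 xz≈yz = x∙y⁻¹≈ε⇒x≈y x y (x≉0∧x*y≈0⇒y≈0 z≉0 (begin
    z * (x - y)      ≈⟨ *-comm z (x - y) ⟩
    (x - y) * z      ≈⟨ [y-z]x≈yx-zx z x y ⟩
    x * z - y * z    ≈⟨ +-congʳ xz≈yz ⟩
    y * z - y * z    ≈⟨ -‿inverseʳ (y * z) ⟩
    0#               ∎))

  *-cancelˡ : ∀ {x y z} → z ≉ 0# → z * x ≈ z * y → x ≈ y
  *-cancelˡ z≉0 zx≈zy = *-cancelʳ z≉0 (trans (*-comm _ _) (trans zx≈zy (*-comm _ _)))

  *-inverse-unique : ∀ {x y z} → x * y ≈ 1# → x * z ≈ 1# → y ≈ z
  *-inverse-unique {x} {y} {z} xy≈1 xz≈1 = begin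
    y              ≈⟨ *-identityˡ y ⟨
    1# * y         ≈⟨ *-congʳ xz≈1 ⟨
    (x * z) * y    ≈⟨ *-congʳ (*-comm x z) ⟩
    (z * x) * y    ≈⟨ *-assoc z x y ⟩
    z * (x * y)    ≈⟨ *-congˡ xy≈1 ⟩
    z * 1#         ≈⟨ *-identityʳ z ⟩
    z              ∎

  inverse-^ : ∀ {x y n j} → x * y ≈ 1# → y ^ n ≈ 1# → j < n → x ^ (n ∸ 1 ∸ j) ≈ y ^ suc j
  inverse-^ {x} {y} {n} {j} xy≈1 yⁿ≈1 j<n = begin
    x ^ s                       ≈⟨ *-identityʳ (x ^ s) ⟨
    x ^ s * 1#                  ≈⟨ *-congˡ yⁿ≈1 ⟨
    x ^ s * y ^ n               ≡⟨ ≡.cong (λ e → x ^ s * y ^ e) s+[1+j]≡n ⟨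
    x ^ s * y ^ (s +ℕ suc j)    ≈⟨ *-congˡ (^-homo-* y s (suc j)) ⟩
    x ^ s * (y ^ s * y ^ suc j) ≈⟨ *-assoc (x ^ s) (y ^ s) (y ^ suc j) ⟨
    x ^ s * y ^ s * y ^ suc j   ≈⟨ *-congʳ (^-distrib-* x y s) ⟨
    (x * y) ^ s * y ^ suc j     ≈⟨ *-congʳ (trans (^-congˡ s xy≈1) (1^n≈1 s)) ⟩
    1# * y ^ suc j              ≈⟨ *-identityˡ (y ^ suc j) ⟩
    y ^ suc j                   ∎
    where
    s = n ∸ 1 ∸ j
    s+[1+j]≡n : s +ℕ suc j ≡ n
    s+[1+j]≡n = ≡.trans (≡.cong (_+ℕ suc j) (ℕ.∸-+-assoc n 1 j)) (ℕ.m∸n+n≡m j<n)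

  ×1-homo-^ : ∀ p e → (p ^ℕ e) × 1# ≈ (p × 1#) ^ e
  ×1-homo-^ p zero    = +-identityʳ 1#
  ×1-homo-^ p (suc e) = trans (×1-homo-* p (p ^ℕ e)) (*-congˡ (×1-homo-^ p e))

  ∣n∸1⇒×1≉0 : ∀ {n d} → n × 1# ≈ 0# → 0 < n → d ∣ n ∸ 1 → d × 1# ≉ 0#
  ∣n∸1⇒×1≉0 {n} {d} n×1≈0 0<n (divides t n∸1≡t*d) d×1≈0 = 1≉0 (begin
    1#                         ≈⟨ +-identityʳ 1# ⟨
    1# + 0#                    ≈⟨ +-congˡ (trans (*-congˡ d×1≈0) (zeroʳ (t × 1#))) ⟨
    1# + (t × 1#) * (d × 1#)   ≈⟨ +-congˡ (×1-homo-* t d) ⟨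
    1# + (t *ℕ d) × 1#         ≡⟨ ≡.cong (_× 1#) n≡1+t*d ⟨
    n × 1#                     ≈⟨ n×1≈0 ⟩
    0#                         ∎)
    where
    n≡1+t*d : n ≡ suc (t *ℕ d)
    n≡1+t*d = ≡.trans (≡.sym (ℕ.m+[n∸m]≡n 0<n)) (≡.cong suc n∸1≡t*d)

  geometric-telescope : ∀ r n → r * ∑ n (r ^_) + 1# ≈ ∑ n (r ^_) + r ^ n
  geometric-telescope r zero    = +-congʳ (zeroʳ r)
  geometric-telescope r (suc n) = begin
    r * (∑ n (r ^_) + r ^ n) + 1#      ≈⟨ regroup r (∑ n (r ^_)) (r ^ n) ⟩
    (r * ∑ n (r ^_) + 1#) + r * r ^ n  ≈⟨ +-congʳ (geometric-telescope r n) ⟩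
    (∑ n (r ^_) + r ^ n) + r ^ suc n   ∎
    where
    regroup : ∀ r s t → r * (s + t) + 1# ≈ (r * s + 1#) + r * t
    regroup = solve 3 (λ r s t → r :* (s :+ t) :+ con 1 := (r :* s :+ con 1) :+ r :* t) refl

  geometric-sum≈0 : ∀ {r} n → r ^ n ≈ 1# → r ≉ 1# → ∑ n (r ^_) ≈ 0#
  geometric-sum≈0 {r} n rⁿ≈1 r≉1 = x≉0∧x*y≈0⇒y≈0 r-1≉0 (begin
    (r - 1#) * S       ≈⟨ [y-z]x≈yx-zx S r 1# ⟩
    r * S - 1# * S     ≈⟨ +-cong rS≈S (-‿cong (*-identityˡ S)) ⟩
    S - S              ≈⟨ -‿inverseʳ S ⟩
    0#                 ∎)
    where
    S = ∑ n (r ^_)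
    r-1≉0 : r - 1# ≉ 0#
    r-1≉0 = r≉1 ∘ x∙y⁻¹≈ε⇒x≈y r 1#
    rS≈S : r * S ≈ S
    rS≈S = +-cancelʳ 1# (r * S) S (trans (geometric-telescope r n) (+-congˡ rⁿ≈1))

module FiniteField {c ℓ} (K : CommutativeRing c ℓ) (isField : IsField K) {N : ℕ} (card : HasCardinality K N) where
  open CommutativeRing K
  open import Relation.Binary.Reasoning.Setoid setoid
  open import Algebra.Properties.CommutativeSemiring.Exp commutativeSemiring using (_^_; ^-congˡ)
  open import Algebra.Properties.Semiring.Mult semiring using (_×_)
  open Field K isField
  open Inverse card using (to; from; to-cong; strictlyInverseˡ; strictlyInverseʳ)

  _≟_ : Decidable _≈_
  x ≟ y with to x Fin.≟ to y
  ... | yes tx≡ty = yes (begin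
    x              ≈⟨ strictlyInverseʳ x ⟨
    from (to x)    ≡⟨ ≡.cong from tx≡ty ⟩
    from (to y)    ≈⟨ strictlyInverseʳ y ⟩
    y              ∎)
  ... | no tx≢ty = no (tx≢ty ∘ to-cong)

  x^n≈0⇒x≈0 : ∀ {x} n → x ^ n ≈ 0# → x ≈ 0#
  x^n≈0⇒x≈0 {x} n xⁿ≈0 with x ≟ 0#
  ... | yes x≈0 = x≈0
  ... | no  x≉0 = ⊥-elim (x≉0⇒x^n≉0 n x≉0 xⁿ≈0)

  ≈-inverse : (h h⁻¹ : Carrier → Carrier) →
              (∀ {x y} → x ≈ y → h x ≈ h y) → (∀ {x y} → x ≈ y → h⁻¹ x ≈ h⁻¹ y) →
              (∀ x → h (h⁻¹ x) ≈ x) → (∀ x → h⁻¹ (h x) ≈ x) → Inverse setoid setoid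
  ≈-inverse h h⁻¹ h-cong h⁻¹-cong hh⁻¹ h⁻¹h = record
    { to        = h
    ; from      = h⁻¹
    ; to-cong   = h-cong
    ; from-cong = h⁻¹-cong
    ; inverse   = (λ y≈h⁻¹x → trans (h-cong y≈h⁻¹x) (hh⁻¹ _))
                , (λ y≈hx → trans (h⁻¹-cong y≈hx) (h⁻¹h _))
    }

  module Total {a ℓ′} (M : CommutativeMonoid a ℓ′) where
    private module M = CommutativeMonoid M
    open import Algebra.Properties.CommutativeMonoid.Sum M
      using (sum; sum-cong-≋; sum-remove; sum-replicate; sum-replicate-zero; ∑-distrib-+; ∑-permute)
    open import Algebra.Definitions.RawMonoid M.rawMonoid using () renaming (_×_ to _×ᴹ_)

    Respects≈ : (Carrier → M.Carrier) → Set _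
    Respects≈ F = ∀ {x y} → x ≈ y → F x M.≈ F y

    total : (Carrier → M.Carrier) → M.Carrier
    total F = sum (F ∘ from)

    total-reindex : ∀ {F} → Respects≈ F → (h : Inverse setoid setoid) → total F M.≈ total (F ∘ Inverse.to h)
    total-reindex {F} F-cong h = M.trans (∑-permute (F ∘ from) π)
      (sum-cong-≋ {N} λ i → F-cong (strictlyInverseʳ _))
      where π = Compose.inverse (Symmetry.inverse card) (Compose.inverse h card)

    total-cong : ∀ {F G} → (∀ x → F x M.≈ G x) → total F M.≈ total G
    total-cong F≈G = sum-cong-≋ {N} (F≈G ∘ from)

    total-distrib : ∀ F G → total (λ x → F x M.∙ G x) M.≈ total F M.∙ total G
    total-distrib F G = ∑-distrib-+ (F ∘ from) (G ∘ from)

    total-const : ∀ m → total (λ _ → m) M.≈ N ×ᴹ m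
    total-const m = sum-replicate N

    sum-single : ∀ {n} (t : Fin n → M.Carrier) i → (∀ j → j ≢ i → t j M.≈ M.ε) → sum t M.≈ t i
    sum-single {suc n} t i t≈ε = M.trans (sum-remove t) (M.trans (M.∙-congˡ (M.trans
      (sum-cong-≋ λ j → t≈ε _ (Fin.punchInᵢ≢i i j)) (sum-replicate-zero n))) (M.identityʳ (t i)))

    total-single : ∀ {F} → Respects≈ F → ∀ x₀ → (∀ x → x ≉ x₀ → F x M.≈ M.ε) → total F M.≈ F x₀
    total-single {F} F-cong x₀ F≈ε = M.trans
      (sum-single (F ∘ from) (to x₀) λ j j≢x₀ → F≈ε (from j) λ fj≈x₀ →
        j≢x₀ (≡.trans (≡.sym (strictlyInverseˡ j)) (to-cong fj≈x₀)))
      (F-cong (strictlyInverseʳ x₀))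

  private
    module ΣK = Total +-commutativeMonoid
    module ΠK = Total *-commutativeMonoid
  open import Algebra.Properties.Group +-group using (identityʳ-unique)
  open import Algebra.Properties.CommutativeMonoid.Sum *-commutativeMonoid using () renaming (sum to ∏)

  N×1≈0 : N × 1# ≈ 0#
  N×1≈0 = identityʳ-unique S (N × 1#) (begin
    S + N × 1#                    ≈⟨ +-congˡ (ΣK.total-const 1#) ⟨
    S + ΣK.total (λ _ → 1#)       ≈⟨ ΣK.total-distrib (λ x → x) (λ _ → 1#) ⟨
    ΣK.total (λ x → x + 1#)       ≈⟨ ΣK.total-reindex (λ x≈y → x≈y) translation ⟨
    S                             ∎)
    where
    S = ΣK.total (λ x → x)
    translation : Inverse setoid setoid
    translation = ≈-inverse (_+ 1#) (_- 1#) +-congʳ +-congʳ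
      (λ x → trans (+-assoc x (- 1#) 1#) (trans (+-congˡ (-‿inverseˡ 1#)) (+-identityʳ x)))
      (λ x → trans (+-assoc x 1# (- 1#)) (trans (+-congˡ (-‿inverseʳ 1#)) (+-identityʳ x)))

  ifZero : Carrier → (Carrier → Carrier) → Carrier → Carrier
  ifZero z f x with x ≟ 0#
  ... | yes _ = z
  ... | no  _ = f x

  ifZero-≈0 : ∀ z f {x} → x ≈ 0# → ifZero z f x ≈ z
  ifZero-≈0 z f {x} x≈0 with x ≟ 0#
  ... | yes _   = refl
  ... | no  x≉0 = ⊥-elim (x≉0 x≈0)

  ifZero-≉0 : ∀ z f {x} → x ≉ 0# → ifZero z f x ≈ f x
  ifZero-≉0 z f {x} x≉0 with x ≟ 0#
  ... | yes x≈0 = ⊥-elim (x≉0 x≈0)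
  ... | no  _   = refl

  ifZero-cong : ∀ z {f} → (∀ {x y} → x ≈ y → f x ≈ f y) →
                ∀ {x y} → x ≈ y → ifZero z f x ≈ ifZero z f y
  ifZero-cong z {f} f-cong {x} {y} x≈y with x ≟ 0#
  ... | yes x≈0 = sym (ifZero-≈0 z f (trans (sym x≈y) x≈0))
  ... | no  x≉0 = trans (f-cong x≈y) (sym (ifZero-≉0 z f (x≉0 ∘ trans x≈y)))

  nonzeroPart : Carrier → Carrier
  nonzeroPart = ifZero 1# (λ x → x)

  nonzeroPart≉0 : ∀ x → nonzeroPart x ≉ 0#
  nonzeroPart≉0 x with x ≟ 0#
  ... | yes _   = 1≉0
  ... | no  x≉0 = x≉0

  ∏-≉0 : ∀ {n} (t : Fin n → Carrier) → (∀ i → t i ≉ 0#) → ∏ t ≉ 0#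
  ∏-≉0 {zero}  t t≉0 = 1≉0
  ∏-≉0 {suc n} t t≉0 = x≉0∧y≉0⇒x*y≉0 (t≉0 Fin.zero) (∏-≉0 (t ∘ Fin.suc) (t≉0 ∘ Fin.suc))

  fermat-≉0 : ∀ {a} → a ≉ 0# → a ^ N ≈ a
  fermat-≉0 {a} a≉0 with proj₂ isField a a≉0
  ... | a⁻¹ , aa⁻¹≈1 = *-cancelʳ (∏-≉0 _ (nonzeroPart≉0 ∘ from)) (begin
    a ^ N * P                                    ≈⟨ *-congʳ (ΠK.total-const a) ⟨
    ΠK.total (λ _ → a) * P                       ≈⟨ ΠK.total-distrib (λ _ → a) nonzeroPart ⟨
    ΠK.total (λ x → a * nonzeroPart x)           ≈⟨ ΠK.total-cong scale-nonzeroPart ⟩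
    ΠK.total (λ x → δ x * nonzeroPart (a * x))   ≈⟨ ΠK.total-distrib δ (nonzeroPart ∘ (a *_)) ⟩
    ΠK.total δ * ΠK.total (nonzeroPart ∘ (a *_)) ≈⟨ *-cong δ-total (sym (ΠK.total-reindex nzp-cong scaling)) ⟩
    a * P                                        ∎)
    where
    P = ΠK.total nonzeroPart
    nzp-cong = ifZero-cong 1# (λ x≈y → x≈y)
    -- δ accounts for x = 0, where nonzeroPart is 1 on both sides.
    δ = ifZero a (λ _ → 1#)
    δ-total : ΠK.total δ ≈ a
    δ-total = trans (ΠK.total-single (ifZero-cong a (λ _ → refl)) 0# (λ _ → ifZero-≉0 a _))
                    (ifZero-≈0 a (λ _ → 1#) refl)
    scale-nonzeroPart : ∀ x → a * nonzeroPart x ≈ δ x * nonzeroPart (a * x)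
    scale-nonzeroPart x with x ≟ 0#
    ... | yes x≈0 = *-congˡ (sym (ifZero-≈0 1# _ (trans (*-congˡ x≈0) (zeroʳ a))))
    ... | no  x≉0 = sym (trans (*-identityˡ _) (ifZero-≉0 1# _ (x≉0∧y≉0⇒x*y≉0 a≉0 x≉0)))
    scaling : Inverse setoid setoid
    scaling = ≈-inverse (a *_) (a⁻¹ *_) *-congˡ *-congˡ
                        (cancel aa⁻¹≈1) (cancel (trans (*-comm a⁻¹ a) aa⁻¹≈1))
      where
      cancel : ∀ {b c} → b * c ≈ 1# → ∀ x → b * (c * x) ≈ x
      cancel {b} {c} bc≈1 x = trans (sym (*-assoc b c x)) (trans (*-congʳ bc≈1) (*-identityˡ x))

  fermat : ∀ x → x ^ N ≈ x
  fermat x with x ≟ 0#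
  ... | no  x≉0 = fermat-≉0 x≉0
  ... | yes x≈0 = trans (^-congˡ N x≈0) (trans (0^n≈0 (ℕ.≤-<-trans z≤n (Fin.toℕ<n (to 0#)))) (sym x≈0))

  x*x^[N∸2]≈1 : 2 ≤ N → ∀ {x} → x ≉ 0# → x * x ^ (N ∸ 2) ≈ 1#
  x*x^[N∸2]≈1 2≤N {x} x≉0 = *-cancelˡ x≉0 (begin
    x * (x * x ^ (N ∸ 2))   ≡⟨ ≡.cong (x ^_) (ℕ.m+[n∸m]≡n 2≤N) ⟩
    x ^ N                   ≈⟨ fermat x ⟩
    x                       ≈⟨ *-identityʳ x ⟨
    x * 1#                  ∎)

  -- x ^ (N ∸ 2) is x⁻¹ for x ≉ 0 and 0 for x ≈ 0 (this needs N ≠ 2).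
  ^[N∸2]-involutive : 3 ≤ N → ∀ x → (x ^ (N ∸ 2)) ^ (N ∸ 2) ≈ x
  ^[N∸2]-involutive 3≤N x with x ≟ 0#
  ... | no  x≉0 = sym (*-inverse-unique (trans (*-comm _ x) (x*x^[N∸2]≈1 2≤N x≉0))
                                      (x*x^[N∸2]≈1 2≤N (x≉0⇒x^n≉0 (N ∸ 2) x≉0)))
    where 2≤N = ℕ.<⇒≤ 3≤N
  ... | yes x≈0 = begin
    (x ^ (N ∸ 2)) ^ (N ∸ 2)   ≈⟨ ^-congˡ (N ∸ 2) (trans (^-congˡ (N ∸ 2) x≈0) 0^[N∸2]≈0) ⟩
    0# ^ (N ∸ 2)              ≈⟨ 0^[N∸2]≈0 ⟩
    0#                        ≈⟨ x≈0 ⟨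
    x                         ∎
    where 0^[N∸2]≈0 = 0^n≈0 (ℕ.m<n⇒0<n∸m 3≤N)

  N≡p^e⇒p×1≈0 : ∀ {p e} → N ≡ p ^ℕ e → p × 1# ≈ 0#
  N≡p^e⇒p×1≈0 {p} {e} N≡pᵉ = x^n≈0⇒x≈0 e (begin
    (p × 1#) ^ e     ≈⟨ ×1-homo-^ p e ⟨
    (p ^ℕ e) × 1#    ≡⟨ ≡.cong (_× 1#) N≡pᵉ ⟨
    N × 1#           ≈⟨ N×1≈0 ⟩
    0#               ∎)

module Frobenius {c ℓ} (K : CommutativeRing c ℓ) where
  open CommutativeRing K
  open import Relation.Binary.Reasoning.Setoid setoid
  open import Algebra.Properties.CommutativeSemiring.Exp commutativeSemiring using (_^_; ^-assocʳ; ^-congˡ)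
  open import Algebra.Properties.Semiring.Mult semiring using (_×_; ×-assocˡ; ×-assoc-*; ×-congʳ; ×-homo-1)
  open import Algebra.Properties.Semiring.Sum semiring using (sum; sum-cong-≋; sum-init-last; sum-replicate-zero)
  open import Algebra.Properties.CommutativeSemiring.Binomial commutativeSemiring using (theorem; binomialTerm)
  open import Data.Vec.Functional using (init; tail; last)

  char∣n⇒n×x≈0 : ∀ {p n} → p × 1# ≈ 0# → p ∣ n → ∀ x → n × x ≈ 0#
  char∣n⇒n×x≈0 {p} p×1≈0 (divides m ≡.refl) x = begin
    (m *ℕ p) × x        ≡⟨ ≡.cong (_× x) (ℕ.*-comm m p) ⟩
    (p *ℕ m) × x        ≈⟨ ×-assocˡ x p m ⟨
    p × (m × x)         ≈⟨ ×-congʳ p (*-identityˡ (m × x)) ⟨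
    p × (1# * m × x)    ≈⟨ ×-assoc-* p 1# (m × x) ⟨
    (p × 1#) * m × x    ≈⟨ *-congʳ p×1≈0 ⟩
    0# * m × x          ≈⟨ zeroˡ (m × x) ⟩
    0#                  ∎

  IsAdditivePower : ℕ → Set (c ⊔ ℓ)
  IsAdditivePower n = ∀ x y → (x + y) ^ n ≈ x ^ n + y ^ n

  isAdditivePower-1 : IsAdditivePower 1
  isAdditivePower-1 x y = trans (*-identityʳ (x + y)) (sym (+-cong (*-identityʳ x) (*-identityʳ y)))

  isAdditivePower-* : ∀ {m n} → IsAdditivePower m → IsAdditivePower n → IsAdditivePower (m *ℕ n)
  isAdditivePower-* {m} {n} add-m add-n x y = begin
    (x + y) ^ (m *ℕ n)            ≈⟨ ^-assocʳ (x + y) m n ⟨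
    ((x + y) ^ m) ^ n             ≈⟨ ^-congˡ n (add-m x y) ⟩
    (x ^ m + y ^ m) ^ n           ≈⟨ add-n (x ^ m) (y ^ m) ⟩
    (x ^ m) ^ n + (y ^ m) ^ n     ≈⟨ +-cong (^-assocʳ x m n) (^-assocʳ y m n) ⟩
    x ^ (m *ℕ n) + y ^ (m *ℕ n)   ∎

  isAdditivePower-^ : ∀ {n} → IsAdditivePower n → ∀ e → IsAdditivePower (n ^ℕ e)
  isAdditivePower-^ add-n zero    = isAdditivePower-1
  isAdditivePower-^ {n} add-n (suc e) = isAdditivePower-* {n} {n ^ℕ e} add-n (isAdditivePower-^ add-n e)

  isAdditivePower-char : ∀ {p} → Prime p → p × 1# ≈ 0# → IsAdditivePower p
  isAdditivePower-char {p} p-prime p×1≈0 x y with prime>1 p-prime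
  ... | s≤s (s≤s {n = p₋₂} z≤n) = begin
    (x + y) ^ p                                          ≈⟨ theorem p x y ⟩
    t Fin.zero + sum (tail t)                            ≈⟨ +-congˡ (sum-init-last (tail t)) ⟩
    t Fin.zero + (sum (init (tail t)) + last (tail t))   ≈⟨ +-cong first (+-cong middle last≈xᵖ) ⟩
    y ^ p + (0# + x ^ p)                                 ≈⟨ +-congˡ (+-identityˡ (x ^ p)) ⟩
    y ^ p + x ^ p                                        ≈⟨ +-comm (y ^ p) (x ^ p) ⟩
    x ^ p + y ^ p                                        ∎
    where
    t = binomialTerm x y p
    term : ∀ k {m} → Fin.toℕ k ≡ m → t k ≈ (p C m) × (x ^ m * y ^ (p ∸ m))
    term k ≡.refl = refl
    first : t Fin.zero ≈ y ^ p
    first = begin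
      t Fin.zero               ≡⟨ ≡.cong (_× (1# * y ^ p)) (≡.trans (nCk≡nC[n∸k] {0} {p} z≤n) (nCn≡1 p)) ⟩
      1 × (1# * y ^ p)         ≈⟨ trans (×-homo-1 _) (*-identityˡ (y ^ p)) ⟩
      y ^ p                    ∎
    middle : sum (init (tail t)) ≈ 0#
    middle = trans (sum-cong-≋ {suc p₋₂} λ j → trans (term _ (≡.cong suc (Fin.toℕ-inject₁ j)))
      (char∣n⇒n×x≈0 p×1≈0 (prime∣C p-prime (s≤s z≤n) (s≤s (Fin.toℕ<n j))) _))
      (sum-replicate-zero (suc p₋₂))
    last≈xᵖ : last (tail t) ≈ x ^ p
    last≈xᵖ = begin
      last (tail t)                ≈⟨ term _ (≡.cong suc (Fin.toℕ-fromℕ (suc p₋₂))) ⟩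
      (p C p) × (x ^ p * y ^ (p ∸ p)) ≡⟨ ≡.cong₂ (λ n e → n × (x ^ p * y ^ e)) (nCn≡1 p) (ℕ.n∸n≡0 p) ⟩
      1 × (x ^ p * 1#)             ≈⟨ trans (×-homo-1 _) (*-identityʳ (x ^ p)) ⟩
      x ^ p                        ∎

module PrimitiveRoots {c ℓ} (K : CommutativeRing c ℓ) (isField : IsField K) {d : ℕ} (1<d : 1 < d)
                      (ω : CommutativeRing.Carrier K) (ω-primitive : PrimitiveRoot K d ω) where
  open CommutativeRing K
  open import Relation.Binary.Reasoning.Setoid setoid
  open import Algebra.Properties.CommutativeSemiring.Exp commutativeSemiring
    using (_^_; ^-congˡ; ^-homo-*; ^-assocʳ; ^-distrib-*)
  open import Algebra.Properties.Semiring.Mult semiring using (_×_)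
  open Sums K
  open Field K isField

  ωᵈ≈1 : ω ^ d ≈ 1#
  ωᵈ≈1 = proj₁ ω-primitive

  0<d : 0 < d
  0<d = ℕ.<-trans (s≤s z≤n) 1<d

  ω≉0 : ω ≉ 0#
  ω≉0 ω≈0 = 1≉0 (begin
    1#      ≈⟨ ωᵈ≈1 ⟨
    ω ^ d   ≈⟨ ^-congˡ d ω≈0 ⟩
    0# ^ d  ≈⟨ 0^n≈0 0<d ⟩
    0#      ∎)

  ω^i≉ω^j : ∀ {i j} → i < j → j < d → ω ^ i ≉ ω ^ j
  ω^i≉ω^j {i} {j} i<j j<d ωⁱ≈ωʲ = proj₂ ω-primitive (j ∸ i) (ℕ.m<n⇒0<n∸m i<j)
    (ℕ.≤-<-trans (ℕ.m∸n≤m j i) j<d) (*-cancelˡ (x≉0⇒x^n≉0 i ω≉0) (begin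
      ω ^ i * ω ^ (j ∸ i)   ≈⟨ ^-homo-* ω i (j ∸ i) ⟨
      ω ^ (i +ℕ (j ∸ i))    ≡⟨ ≡.cong (ω ^_) (ℕ.m+[n∸m]≡n (ℕ.<⇒≤ i<j)) ⟩
      ω ^ j                 ≈⟨ ωⁱ≈ωʲ ⟨
      ω ^ i                 ≈⟨ *-identityʳ (ω ^ i) ⟨
      ω ^ i * 1#            ∎))

  ω^-injective : ∀ {i j} → i < d → j < d → ω ^ i ≈ ω ^ j → i ≡ j
  ω^-injective {i} {j} i<d j<d ωⁱ≈ωʲ with ℕ.<-cmp i j
  ... | tri< i<j _ _ = ⊥-elim (ω^i≉ω^j i<j j<d ωⁱ≈ωʲ)
  ... | tri≈ _ i≡j _ = i≡j
  ... | tri> _ _ j<i = ⊥-elim (ω^i≉ω^j j<i i<d (sym ωⁱ≈ωʲ))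

  neg : ℕ → ℕ
  neg zero    = 0
  neg (suc k) = d ∸ suc k

  neg<d : ∀ {k} → k < d → neg k < d
  neg<d {zero}  _ = 0<d
  neg<d {suc k} k<d = ℕ.∸-monoʳ-< {d} {suc k} {0} (s≤s z≤n) (ℕ.<⇒≤ k<d)

  ω^k*ω^neg≈1 : ∀ {k} → k < d → ω ^ k * ω ^ neg k ≈ 1#
  ω^k*ω^neg≈1 {zero}  _   = *-identityˡ 1#
  ω^k*ω^neg≈1 {suc k} k<d = begin
    ω ^ suc k * ω ^ (d ∸ suc k)   ≈⟨ ^-homo-* ω (suc k) (d ∸ suc k) ⟨
    ω ^ (suc k +ℕ (d ∸ suc k))    ≡⟨ ≡.cong (ω ^_) (ℕ.m+[n∸m]≡n (ℕ.<⇒≤ k<d)) ⟩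
    ω ^ d                         ≈⟨ ωᵈ≈1 ⟩
    1#                            ∎

  ω⁻¹ : Carrier
  ω⁻¹ = ω ^ (d ∸ 1)

  ω*ω⁻¹≈1 : ω * ω⁻¹ ≈ 1#
  ω*ω⁻¹≈1 = trans (*-congʳ (sym (*-identityʳ ω))) (ω^k*ω^neg≈1 {1} 1<d)

  ω^k*ω⁻¹^k≈1 : ∀ k → ω ^ k * ω⁻¹ ^ k ≈ 1#
  ω^k*ω⁻¹^k≈1 k = begin
    ω ^ k * ω⁻¹ ^ k    ≈⟨ ^-distrib-* ω ω⁻¹ k ⟨
    (ω * ω⁻¹) ^ k      ≈⟨ ^-congˡ k ω*ω⁻¹≈1 ⟩
    1# ^ k             ≈⟨ 1^n≈1 k ⟩
    1#                 ∎

  ω^neg≈ω⁻¹^k : ∀ {k} → k < d → ω ^ neg k ≈ ω⁻¹ ^ k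
  ω^neg≈ω⁻¹^k {k} k<d = *-inverse-unique (ω^k*ω^neg≈1 k<d) (ω^k*ω⁻¹^k≈1 k)

  ω^k*ω^i≈1⇒i≡neg : ∀ {k i} → k < d → i < d → ω ^ k * ω ^ i ≈ 1# → i ≡ neg k
  ω^k*ω^i≈1⇒i≡neg k<d i<d ωᵏωⁱ≈1 =
    ω^-injective i<d (neg<d k<d) (*-inverse-unique ωᵏωⁱ≈1 (ω^k*ω^neg≈1 k<d))

  ω⁻¹^[1+j]≈1⇒j≡d∸1 : ∀ {j} → j < d → ω⁻¹ ^ suc j ≈ 1# → j ≡ d ∸ 1
  ω⁻¹^[1+j]≈1⇒j≡d∸1 {j} j<d ω⁻¹^[1+j]≈1 with suc j ℕ.<? d
  ... | no  1+j≮d = ≡.cong (_∸ 1) (ℕ.≤-antisym j<d (ℕ.≮⇒≥ 1+j≮d))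
  ... | yes 1+j<d = contradiction ω^[1+j]≈1 (proj₂ ω-primitive (suc j) (s≤s z≤n) 1+j<d)
    where
    ω^[1+j]≈1 : ω ^ suc j ≈ 1#
    ω^[1+j]≈1 = trans (sym (*-identityʳ _)) (trans (*-congˡ (sym ω⁻¹^[1+j]≈1)) (ω^k*ω⁻¹^k≈1 (suc j)))

  [ω^a]ᵈ≈1 : ∀ a → (ω ^ a) ^ d ≈ 1#
  [ω^a]ᵈ≈1 a = begin
    (ω ^ a) ^ d    ≈⟨ ^-assocʳ ω a d ⟩
    ω ^ (a *ℕ d)   ≡⟨ ≡.cong (ω ^_) (ℕ.*-comm a d) ⟩
    ω ^ (d *ℕ a)   ≈⟨ ^-assocʳ ω d a ⟨
    (ω ^ d) ^ a    ≈⟨ ^-congˡ a ωᵈ≈1 ⟩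
    1# ^ a         ≈⟨ 1^n≈1 a ⟩
    1#             ∎

  [ω⁻¹^a]ᵈ≈1 : ∀ a → (ω⁻¹ ^ a) ^ d ≈ 1#
  [ω⁻¹^a]ᵈ≈1 a = trans (^-congˡ d (^-assocʳ ω (d ∸ 1) a)) ([ω^a]ᵈ≈1 ((d ∸ 1) *ℕ a))

  D : Carrier
  D = d × 1#

  ∑-orthogonal : ∀ (g ξ : ℕ → Carrier) {i₀} → i₀ < d → (∀ i → i < d → ξ i ^ d ≈ 1#) →
                 (∀ i → i < d → ξ i ≈ 1# → i ≡ i₀) → ξ i₀ ≈ 1# →
                 ∑ d (λ i → g i * ∑ d (ξ i ^_)) ≈ g i₀ * D
  ∑-orthogonal g ξ {i₀} i₀<d ξᵈ≈1 ξ≈1⇒i≡i₀ ξi₀≈1 = begin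
    ∑ d (λ i → g i * ∑ d (ξ i ^_))  ≈⟨ ∑-select d _ i₀<d vanishing ⟩
    g i₀ * ∑ d (ξ i₀ ^_)            ≈⟨ *-congˡ (∑-cong d λ j _ → trans (^-congˡ j ξi₀≈1) (1^n≈1 j)) ⟩
    g i₀ * ∑ d (λ _ → 1#)           ≈⟨ *-congˡ (∑-const d 1#) ⟩
    g i₀ * D                        ∎
    where
    vanishing : ∀ i → i < d → i ≢ i₀ → g i * ∑ d (ξ i ^_) ≈ 0#
    vanishing i i<d i≢i₀ =
      trans (*-congˡ (geometric-sum≈0 d (ξᵈ≈1 i i<d) (i≢i₀ ∘ ξ≈1⇒i≡i₀ i i<d))) (zeroʳ (g i))

module Involution {c ℓ} (K : CommutativeRing c ℓ) (isField : IsField K)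
                  {p k d : ℕ} (p-prime : Prime p) (1≤k : 1 ≤ k) (1<d : 1 < d) (d∣q∸1 : d ∣ p ^ℕ k ∸ 1)
                  (card : HasCardinality K ((p ^ℕ k) ^ℕ d)) where
  open CommutativeRing K
  open import Relation.Binary.Reasoning.Setoid setoid
  open import Algebra.Properties.CommutativeSemiring.Exp commutativeSemiring
    using (_^_; ^-congˡ; ^-congʳ; ^-assocʳ; ^-distrib-*)
  open import Algebra.Properties.Semiring.Mult semiring using (_×_)
  open import Algebra.Properties.Group +-group using () renaming (∙-cancelʳ to +-cancelʳ)
  open import Algebra.Properties.CommutativeSemigroup *-commutativeSemigroup using ()
    renaming (x∙yz≈y∙xz to x*yz≈y*xz; x∙yz≈x∙zy to x*yz≈x*zy; x∙yz≈zx∙y to x*yz≈zx*y; xy∙z≈x∙zy to xy*z≈x*zy)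
  open Sums K
  open Field K isField
  open FiniteField K isField card
  open Frobenius K

  q N m : ℕ
  q = p ^ℕ k
  N = q ^ℕ d
  m = N ∸ 2

  instance
    p≢0 : ℕ.NonZero p
    p≢0 = ℕ.nonTrivial⇒nonZero p {{prime⇒nonTrivial p-prime}}
    q≢0 : ℕ.NonZero q
    q≢0 = ℕ.m^n≢0 p k

  2≤q : 2 ≤ q
  2≤q = ℕ.≤-trans (prime>1 p-prime)
          (ℕ.≤-trans (ℕ.≤-reflexive (≡.sym (ℕ.*-identityʳ p))) (ℕ.^-monoʳ-≤ p 1≤k))

  3≤N : 3 ≤ N
  3≤N = ℕ.≤-trans (ℕ.n≤1+n 3) (ℕ.≤-trans (ℕ.^-monoʳ-≤ 2 1<d) (ℕ.^-monoˡ-≤ d 2≤q))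

  p×1≈0 : p × 1# ≈ 0#
  p×1≈0 = N≡p^e⇒p×1≈0 {p} {k *ℕ d} (ℕ.^-*-assoc p k d)

  q×1≈0 : q × 1# ≈ 0#
  q×1≈0 = begin
    q × 1#         ≈⟨ ×1-homo-^ p k ⟩
    (p × 1#) ^ k   ≈⟨ ^-congˡ k p×1≈0 ⟩
    0# ^ k         ≈⟨ 0^n≈0 1≤k ⟩
    0#             ∎

  d×1≉0 : d × 1# ≉ 0#
  d×1≉0 = ∣n∸1⇒×1≉0 q×1≈0 (ℕ.m^n>0 p k) d∣q∸1

  q-additive : IsAdditivePower q
  q-additive = isAdditivePower-^ (isAdditivePower-char p-prime p×1≈0) k

  ∑-^q^t : ∀ t n g → ∑ n g ^ (q ^ℕ t) ≈ ∑ n (λ i → g i ^ (q ^ℕ t))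
  ∑-^q^t t = ∑-homo (_^ (q ^ℕ t)) (0^n≈0 (ℕ.m^n>0 q t)) (isAdditivePower-^ q-additive t)

  ∑-^q : ∀ n g → ∑ n g ^ q ≈ ∑ n (λ i → g i ^ q)
  ∑-^q = ∑-homo (_^ q) (0^n≈0 (ℕ.m^n>0 p k)) q-additive

  ^-comm : ∀ x a b → (x ^ a) ^ b ≈ (x ^ b) ^ a
  ^-comm x a b = trans (^-assocʳ x a b) (trans (^-congʳ x (ℕ.*-comm a b)) (sym (^-assocʳ x b a)))

  fixed-^q^t : ∀ {x} → x ^ q ≈ x → ∀ t → x ^ (q ^ℕ t) ≈ x
  fixed-^q^t {x} xq≈x zero    = *-identityʳ x
  fixed-^q^t {x} xq≈x (suc t) = begin
    x ^ (q *ℕ q ^ℕ t)    ≈⟨ ^-assocʳ x q (q ^ℕ t) ⟨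
    (x ^ q) ^ (q ^ℕ t)   ≈⟨ ^-congˡ (q ^ℕ t) xq≈x ⟩
    x ^ (q ^ℕ t)         ≈⟨ fixed-^q^t xq≈x t ⟩
    x                    ∎

  fixed-^ : ∀ {x} → x ^ q ≈ x → ∀ n → (x ^ n) ^ q ≈ x ^ n
  fixed-^ {x} xq≈x n = trans (^-comm x n q) (^-congˡ n xq≈x)

  eigen-iterate : ∀ {μ z} → μ ^ q ≈ μ → z ^ q ≈ μ * z → ∀ s → z ^ (q ^ℕ s) ≈ μ ^ s * z
  eigen-iterate {μ} {z} μq≈μ zq≈μz zero    = trans (*-identityʳ z) (sym (*-identityˡ z))
  eigen-iterate {μ} {z} μq≈μ zq≈μz (suc s) = begin
    z ^ (q *ℕ q ^ℕ s)               ≈⟨ ^-assocʳ z q (q ^ℕ s) ⟨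
    (z ^ q) ^ (q ^ℕ s)              ≈⟨ ^-congˡ (q ^ℕ s) zq≈μz ⟩
    (μ * z) ^ (q ^ℕ s)              ≈⟨ ^-distrib-* μ z (q ^ℕ s) ⟩
    μ ^ (q ^ℕ s) * z ^ (q ^ℕ s)     ≈⟨ *-cong (fixed-^q^t μq≈μ s) (eigen-iterate μq≈μ zq≈μz s) ⟩
    μ * (μ ^ s * z)                 ≈⟨ *-assoc μ (μ ^ s) z ⟨
    μ ^ suc s * z                   ∎

  twistedTrace : Carrier → Carrier → Carrier
  twistedTrace λ′ x = ∑ d (λ j → λ′ ^ j * x ^ (q ^ℕ (d ∸ 1 ∸ j)))

  -- Raising to the q-th power shifts j by one, and fermat closes up the cycle.
  twistedTrace-eigen : ∀ {λ′} → λ′ ^ q ≈ λ′ → λ′ ^ d ≈ 1# →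
                       ∀ x → twistedTrace λ′ x ^ q ≈ λ′ * twistedTrace λ′ x
  twistedTrace-eigen {λ′} λ′q≈λ′ λ′ᵈ≈1 x = +-cancelʳ (g 0) _ _ (begin
    twistedTrace λ′ x ^ q + g 0          ≈⟨ +-congʳ conjugate ⟩
    ∑ d g + g 0                          ≈⟨ +-congˡ (trans g0≈x (sym gd≈x)) ⟩
    ∑ d g + g d                          ≈⟨ ∑-rotate d g ⟨
    ∑ d (g ∘ suc) + g 0                  ≈⟨ +-congʳ shift ⟨
    λ′ * twistedTrace λ′ x + g 0         ∎)
    where
    g : ℕ → Carrier
    g j = λ′ ^ j * x ^ (q ^ℕ (d ∸ j))
    conjugate : twistedTrace λ′ x ^ q ≈ ∑ d g
    conjugate = trans (∑-^q d _) (∑-cong d conjugate-term)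
      where
      conjugate-term : ∀ j → j < d → (λ′ ^ j * x ^ (q ^ℕ (d ∸ 1 ∸ j))) ^ q ≈ g j
      conjugate-term j j<d = begin
        (λ′ ^ j * x ^ qˢ) ^ q          ≈⟨ ^-distrib-* (λ′ ^ j) _ q ⟩
        (λ′ ^ j) ^ q * (x ^ qˢ) ^ q    ≈⟨ *-cong (fixed-^ λ′q≈λ′ j) (^-assocʳ x qˢ q) ⟩
        λ′ ^ j * x ^ (qˢ *ℕ q)         ≡⟨ ≡.cong (λ e → λ′ ^ j * x ^ e)
                                            (≡.trans (ℕ.*-comm qˢ q) (≡.cong (q ^ℕ_) (suc[n∸1∸j]≡n∸j j<d))) ⟩
        g j                            ∎
        where qˢ = q ^ℕ (d ∸ 1 ∸ j)
    shift : λ′ * twistedTrace λ′ x ≈ ∑ d (g ∘ suc)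
    shift = trans (*-distribˡ-∑ d λ′ _) (∑-cong d λ j _ → begin
      λ′ * (λ′ ^ j * x ^ (q ^ℕ (d ∸ 1 ∸ j)))   ≈⟨ *-assoc λ′ (λ′ ^ j) _ ⟨
      λ′ ^ suc j * x ^ (q ^ℕ (d ∸ 1 ∸ j))      ≡⟨ ≡.cong (λ e → λ′ ^ suc j * x ^ (q ^ℕ e))
                                                      (ℕ.∸-+-assoc d 1 j) ⟩
      g (suc j)                                 ∎)
    g0≈x : g 0 ≈ x
    g0≈x = trans (*-identityˡ _) (fermat x)
    gd≈x : g d ≈ x
    gd≈x = begin
      λ′ ^ d * x ^ (q ^ℕ (d ∸ d))   ≡⟨ ≡.cong (λ e → λ′ ^ d * x ^ (q ^ℕ e)) (ℕ.n∸n≡0 d) ⟩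
      λ′ ^ d * x ^ 1                ≈⟨ *-cong λ′ᵈ≈1 (*-identityʳ x) ⟩
      1# * x                        ≈⟨ *-identityˡ x ⟩
      x                             ∎

  module _ (ω : Carrier) (ω∈Fq : ω ^ q ≈ ω) (ω-primitive : PrimitiveRoot K d ω)
           (u : ℕ → Carrier) (u∈Fq : ∀ i → i < d → u i ^ q ≈ u i) (u₀≉0 : u 0 ≉ 0#)
           (uω≈u₀ : ∀ i → i < d → u i * ω ^ i ≈ u 0) where
    open PrimitiveRoots K isField 1<d ω ω-primitive

    A : ℕ → Carrier → Carrier
    A = Apoly K q d ω

    f : Carrier → Carrier
    f = fpoly K q d ω u

    A≈twistedTrace : ∀ i x → A i x ≈ twistedTrace (ω ^ i) x
    A≈twistedTrace i x = ∑-cong d λ j _ → *-congʳ (sym (^-assocʳ ω i j))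

    A-eigen : ∀ i x → A i x ^ q ≈ ω ^ i * A i x
    A-eigen i x = begin
      A i x ^ q                      ≈⟨ ^-congˡ q (A≈twistedTrace i x) ⟩
      twistedTrace (ω ^ i) x ^ q     ≈⟨ twistedTrace-eigen (fixed-^ ω∈Fq i) ([ω^a]ᵈ≈1 i) x ⟩
      ω ^ i * twistedTrace (ω ^ i) x ≈⟨ *-congˡ (A≈twistedTrace i x) ⟨
      ω ^ i * A i x                  ∎

    [A^m]-eigen : ∀ i x → (A i x ^ m) ^ q ≈ (ω ^ i) ^ m * A i x ^ m
    [A^m]-eigen i x = begin
      (A i x ^ m) ^ q           ≈⟨ ^-comm (A i x) m q ⟩
      (A i x ^ q) ^ m           ≈⟨ ^-congˡ m (A-eigen i x) ⟩
      (ω ^ i * A i x) ^ m       ≈⟨ ^-distrib-* (ω ^ i) (A i x) m ⟩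
      (ω ^ i) ^ m * A i x ^ m   ∎

    f-conjugate : ∀ x {j} → j < d → f x ^ (q ^ℕ (d ∸ 1 ∸ j)) ≈ u 0 * ∑ d (λ i → (ω ^ i) ^ j * A i x ^ m)
    f-conjugate x {j} j<d = begin
      f x ^ (q ^ℕ s)                                   ≈⟨ ∑-^q^t s d _ ⟩
      ∑ d (λ i → (u i * A i x ^ m) ^ (q ^ℕ s))         ≈⟨ ∑-cong d term ⟩
      ∑ d (λ i → u 0 * ((ω ^ i) ^ j * A i x ^ m))      ≈⟨ *-distribˡ-∑ d (u 0) _ ⟨
      u 0 * ∑ d (λ i → (ω ^ i) ^ j * A i x ^ m)        ∎
      where
      s = d ∸ 1 ∸ j
      term : ∀ i → i < d → (u i * A i x ^ m) ^ (q ^ℕ s) ≈ u 0 * ((ω ^ i) ^ j * A i x ^ m)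
      term i i<d = begin
        (u i * y) ^ (q ^ℕ s)                  ≈⟨ ^-distrib-* (u i) y (q ^ℕ s) ⟩
        u i ^ (q ^ℕ s) * y ^ (q ^ℕ s)         ≈⟨ *-cong (fixed-^q^t (u∈Fq i i<d) s)
                                                   (eigen-iterate (fixed-^ (fixed-^ ω∈Fq i) m) ([A^m]-eigen i x) s) ⟩
        u i * (((ω ^ i) ^ m) ^ s * y)         ≈⟨ *-congˡ (*-congʳ (inverse-^ ω^i^m*ω^i≈1 ([ω^a]ᵈ≈1 i) j<d)) ⟩
        u i * ((ω ^ i * (ω ^ i) ^ j) * y)     ≈⟨ *-congˡ (*-assoc (ω ^ i) _ y) ⟩
        u i * (ω ^ i * ((ω ^ i) ^ j * y))     ≈⟨ *-assoc (u i) (ω ^ i) _ ⟨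
        (u i * ω ^ i) * ((ω ^ i) ^ j * y)     ≈⟨ *-congʳ (uω≈u₀ i i<d) ⟩
        u 0 * ((ω ^ i) ^ j * y)               ∎
        where
        y = A i x ^ m
        ω^i^m*ω^i≈1 : (ω ^ i) ^ m * ω ^ i ≈ 1#
        ω^i^m*ω^i≈1 = trans (*-comm _ (ω ^ i)) (x*x^[N∸2]≈1 (ℕ.<⇒≤ 3≤N) (x≉0⇒x^n≉0 i ω≉0))

    A-f : ∀ x {k} → k < d → A k (f x) ≈ (u 0 * D) * A (neg k) x ^ m
    A-f x {k} k<d = begin
      A k (f x)                                            ≈⟨ ∑-cong d (λ j j<d → *-cong (sym (^-assocʳ ω k j))
                                                                                          (f-conjugate x j<d)) ⟩
      ∑ d (λ j → (ω ^ k) ^ j * (u 0 * ∑ d (λ i → (ω ^ i) ^ j * y i)))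
                                                           ≈⟨ ∑-cong d (λ j _ → regroup j) ⟩
      ∑ d (λ j → u 0 * ∑ d (λ i → y i * ξ i ^ j))          ≈⟨ *-distribˡ-∑ d (u 0) _ ⟨
      u 0 * ∑ d (λ j → ∑ d (λ i → y i * ξ i ^ j))          ≈⟨ *-congˡ (∑-comm d d _) ⟩
      u 0 * ∑ d (λ i → ∑ d (λ j → y i * ξ i ^ j))          ≈⟨ *-congˡ (∑-cong d λ i _ → *-distribˡ-∑ d (y i) _) ⟨
      u 0 * ∑ d (λ i → y i * ∑ d (ξ i ^_))                 ≈⟨ *-congˡ orthogonality ⟩
      u 0 * (y (neg k) * D)                                ≈⟨ x*yz≈x*zy (u 0) _ D ⟩
      u 0 * (D * y (neg k))                                ≈⟨ *-assoc (u 0) D _ ⟨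
      (u 0 * D) * y (neg k)                                ∎
      where
      y ξ : ℕ → Carrier
      y i = A i x ^ m
      ξ i = ω ^ k * ω ^ i
      regroup : ∀ j → (ω ^ k) ^ j * (u 0 * ∑ d (λ i → (ω ^ i) ^ j * y i)) ≈ u 0 * ∑ d (λ i → y i * ξ i ^ j)
      regroup j = trans (x*yz≈y*xz _ (u 0) _) (*-congˡ (trans (*-distribˡ-∑ d _ _) (∑-cong d λ i _ → begin
        (ω ^ k) ^ j * ((ω ^ i) ^ j * y i)   ≈⟨ x*yz≈zx*y _ _ (y i) ⟩
        y i * (ω ^ k) ^ j * (ω ^ i) ^ j     ≈⟨ *-assoc (y i) _ _ ⟩
        y i * ((ω ^ k) ^ j * (ω ^ i) ^ j)   ≈⟨ *-congˡ (^-distrib-* (ω ^ k) (ω ^ i) j) ⟨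
        y i * ξ i ^ j                       ∎)))
      ξᵈ≈1 : ∀ i → i < d → ξ i ^ d ≈ 1#
      ξᵈ≈1 i _ = begin
        (ω ^ k * ω ^ i) ^ d          ≈⟨ ^-distrib-* (ω ^ k) (ω ^ i) d ⟩
        (ω ^ k) ^ d * (ω ^ i) ^ d    ≈⟨ *-cong ([ω^a]ᵈ≈1 k) ([ω^a]ᵈ≈1 i) ⟩
        1# * 1#                      ≈⟨ *-identityˡ 1# ⟩
        1#                           ∎
      orthogonality : ∑ d (λ i → y i * ∑ d (ξ i ^_)) ≈ y (neg k) * D
      orthogonality = ∑-orthogonal y ξ (neg<d k<d) ξᵈ≈1 (λ _ → ω^k*ω^i≈1⇒i≡neg k<d) (ω^k*ω^neg≈1 k<d)

    u≈u₀*ω^neg : ∀ {k} → k < d → u k ≈ u 0 * ω ^ neg k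
    u≈u₀*ω^neg {k} k<d = begin
      u k                          ≈⟨ *-identityʳ (u k) ⟨
      u k * 1#                     ≈⟨ *-congˡ (ω^k*ω^neg≈1 k<d) ⟨
      u k * (ω ^ k * ω ^ neg k)    ≈⟨ *-assoc (u k) _ _ ⟨
      (u k * ω ^ k) * ω ^ neg k    ≈⟨ *-congʳ (uω≈u₀ k k<d) ⟩
      u 0 * ω ^ neg k              ∎

    u*ω^[neg*j]≈u₀*[ω⁻¹^[1+j]]^k : ∀ {k} → k < d → ∀ j → u k * ω ^ (neg k *ℕ j) ≈ u 0 * (ω⁻¹ ^ suc j) ^ k
    u*ω^[neg*j]≈u₀*[ω⁻¹^[1+j]]^k {k} k<d j = begin
      u k * ω ^ (neg k *ℕ j)                 ≈⟨ *-cong (u≈u₀*ω^neg k<d) (sym (^-assocʳ ω (neg k) j)) ⟩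
      (u 0 * ω ^ neg k) * (ω ^ neg k) ^ j    ≈⟨ *-assoc (u 0) _ _ ⟩
      u 0 * (ω ^ neg k) ^ suc j              ≈⟨ *-congˡ (^-congˡ (suc j) (ω^neg≈ω⁻¹^k k<d)) ⟩
      u 0 * (ω⁻¹ ^ k) ^ suc j                ≈⟨ *-congˡ (^-comm ω⁻¹ k (suc j)) ⟩
      u 0 * (ω⁻¹ ^ suc j) ^ k                ∎

    ∑-u*A∘neg : ∀ x → ∑ d (λ k → u k * A (neg k) x) ≈ (u 0 * D) * x
    ∑-u*A∘neg x = begin
      ∑ d (λ k → u k * A (neg k) x)                  ≈⟨ ∑-cong d (λ k k<d → trans (*-distribˡ-∑ d (u k) _)
                                                                                  (∑-cong d λ j _ → term k<d j)) ⟩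
      ∑ d (λ k → ∑ d (λ j → u 0 * (X j * ξ j ^ k)))   ≈⟨ ∑-comm d d _ ⟩
      ∑ d (λ j → ∑ d (λ k → u 0 * (X j * ξ j ^ k)))   ≈⟨ ∑-cong d (λ j _ → factor j) ⟨
      ∑ d (λ j → u 0 * (X j * ∑ d (ξ j ^_)))          ≈⟨ *-distribˡ-∑ d (u 0) _ ⟨
      u 0 * ∑ d (λ j → X j * ∑ d (ξ j ^_))            ≈⟨ *-congˡ orthogonality ⟩
      u 0 * (X (d ∸ 1) * D)                          ≈⟨ x*yz≈x*zy (u 0) _ D ⟩
      u 0 * (D * X (d ∸ 1))                          ≈⟨ *-assoc (u 0) D _ ⟨
      (u 0 * D) * X (d ∸ 1)                          ≈⟨ *-congˡ X[d∸1]≈x ⟩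
      (u 0 * D) * x                                  ∎
      where
      X ξ : ℕ → Carrier
      X j = x ^ (q ^ℕ (d ∸ 1 ∸ j))
      ξ j = ω⁻¹ ^ suc j
      term : ∀ {k} → k < d → ∀ j → u k * (ω ^ (neg k *ℕ j) * X j) ≈ u 0 * (X j * ξ j ^ k)
      term {k} k<d j = begin
        u k * (ω ^ (neg k *ℕ j) * X j)    ≈⟨ *-assoc (u k) _ (X j) ⟨
        (u k * ω ^ (neg k *ℕ j)) * X j    ≈⟨ *-congʳ (u*ω^[neg*j]≈u₀*[ω⁻¹^[1+j]]^k k<d j) ⟩
        (u 0 * ξ j ^ k) * X j             ≈⟨ xy*z≈x*zy (u 0) _ (X j) ⟩
        u 0 * (X j * ξ j ^ k)             ∎
      factor : ∀ j → u 0 * (X j * ∑ d (ξ j ^_)) ≈ ∑ d (λ k → u 0 * (X j * ξ j ^ k))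
      factor j = trans (*-congˡ (*-distribˡ-∑ d (X j) _)) (*-distribˡ-∑ d (u 0) _)
      ξ[d∸1]≈1 : ξ (d ∸ 1) ≈ 1#
      ξ[d∸1]≈1 = trans (^-congʳ ω⁻¹ (ℕ.m+[n∸m]≡n 0<d)) ([ω^a]ᵈ≈1 (d ∸ 1))
      orthogonality : ∑ d (λ j → X j * ∑ d (ξ j ^_)) ≈ X (d ∸ 1) * D
      orthogonality = ∑-orthogonal X ξ (neg<d 1<d) (λ j _ → [ω⁻¹^a]ᵈ≈1 (suc j)) (λ _ → ω⁻¹^[1+j]≈1⇒j≡d∸1) ξ[d∸1]≈1
      X[d∸1]≈x : X (d ∸ 1) ≈ x
      X[d∸1]≈x = trans (^-congʳ x (≡.cong (q ^ℕ_) (ℕ.n∸n≡0 (d ∸ 1)))) (*-identityʳ x)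

    f-involutive : ∀ x → f (f x) ≈ x
    f-involutive x = begin
      ∑ d (λ k → u k * A k (f x) ^ m)              ≈⟨ ∑-cong d (λ k k<d → *-congˡ (A-f^m k<d)) ⟩
      ∑ d (λ k → u k * (e ^ m * A (neg k) x))      ≈⟨ ∑-cong d (λ k _ → x*yz≈y*xz (u k) _ _) ⟩
      ∑ d (λ k → e ^ m * (u k * A (neg k) x))      ≈⟨ *-distribˡ-∑ d (e ^ m) _ ⟨
      e ^ m * ∑ d (λ k → u k * A (neg k) x)        ≈⟨ *-congˡ (∑-u*A∘neg x) ⟩
      e ^ m * (e * x)                              ≈⟨ *-assoc (e ^ m) e x ⟨
      (e ^ m * e) * x                              ≈⟨ *-congʳ (trans (*-comm _ e) (x*x^[N∸2]≈1 (ℕ.<⇒≤ 3≤N) e≉0)) ⟩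
      1# * x                                       ≈⟨ *-identityˡ x ⟩
      x                                            ∎
      where
      e : Carrier
      e = u 0 * D
      e≉0 : e ≉ 0#
      e≉0 = x≉0∧y≉0⇒x*y≉0 u₀≉0 d×1≉0
      A-f^m : ∀ {k} → k < d → A k (f x) ^ m ≈ e ^ m * A (neg k) x
      A-f^m {k} k<d = begin
        A k (f x) ^ m                    ≈⟨ ^-congˡ m (A-f x k<d) ⟩
        (e * A (neg k) x ^ m) ^ m        ≈⟨ ^-distrib-* e _ m ⟩
        e ^ m * (A (neg k) x ^ m) ^ m    ≈⟨ *-congˡ (^[N∸2]-involutive 3≤N (A (neg k) x)) ⟩
        e ^ m * A (neg k) x              ∎

open import Data.Nat using (_^_)
open import Data.Product using (_×_)

corollary6p1 : ∀ {c ℓ : Level} (d q : ℕ) → 1 < d → IsPrimePower q → d ∣ (q ∸ 1)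
    → (K : CommutativeRing c ℓ) → IsField K → HasCardinality K (q ^ d)
    → let open CommutativeRing K in
      (ω : Carrier) → InSubfield K q ω → PrimitiveRoot K d ω
    → (u : ℕ → Carrier)
    → (∀ i → i < d → InSubfield K q (u i) × ¬ (u i ≈ 0#))
    → (∀ i j → i < d → j < d → u i * _^ᴿ_ K ω i ≈ u j * _^ᴿ_ K ω j)
    → ∀ a → fpoly K q d ω u (fpoly K q d ω u a) ≈ a
corollary6p1 d q 1<d (p , k , p-prime , 1≤k , ≡.refl) d∣q∸1 K isField card ω ω∈Fq ω-primitive u u∈Fq* uω-const =
  Involution.f-involutive K isField p-prime 1≤k 1<d d∣q∸1 card ω ω∈Fq ω-primitive u
    (λ i i<d → proj₁ (u∈Fq* i i<d)) (proj₂ (u∈Fq* 0 0<d))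
    (λ i i<d → trans (uω-const i 0 i<d 0<d) (*-identityʳ (u 0)))
  where
  open CommutativeRing K
  0<d = ℕ.<-trans (s≤s z≤n) 1<d
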